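{- Let $G'$ be a matching-covered graph, let $P$ be a path of odd length with distinct ends $u,v$ that are vertices of $G'$ and with no internal vertex in $G'$, and suppose $G=G'\cup P$ is matching-covered. For any non-feasible edge set $X$ of $G$: (i) $X\cap E(G')\sim_{G'}\emptyset$ if and only if $X\sim_G\emptyset$; (ii) $X\cap E(G')\sim_{G'}E(G')$ if and only if $X\sim_G E(G)$; (iii) $X\cap E(G')\in\mathcal{N}^*(G')$ if and only if $X\in\mathcal{N}^*(G)$.
   Context: A graph is matching-covered if connected and every edge lies in a perfect matching. For a graph $H$, $X\subseteq E(H)$ is feasible if there are perfect matchings $M_1,M_2$ of $H$ with $|M_1\cap X|\not\equiv|M_2\cap X|\pmod 2$, non-feasible otherwise. $\nabla_H(U)$ is the set of edges with exactly one end in $U$; $X\sim_H Y$ means $X=Y\oplus\nabla_H(U)$ for some $U\subseteq V(H)$. For matching-covered $H$, $\mathcal{N}^*(H)$ is the set of non-feasible $X\subseteq E(H)$ with neither $X\sim_H\emptyset$ nor $X\sim_H E(H)$. -}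

module Defs where

open import Data.Nat using (ℕ; zero; suc; _+_; _*_; _%_; _<?_)
open import Data.Fin using (Fin; toℕ; fromℕ<; _↑ˡ_; _↑ʳ_)
open import Data.Fin.Subset using (Subset; _∈_; _∩_; ∣_∣; ⊤; ⊥)
open import Data.Bool using (Bool; true; false; _xor_)
open import Data.Vec using (Vec; lookup; tabulate; zipWith)
open import Data.Product using (Σ; ∃; ∃-syntax; _×_; _,_; proj₁; proj₂)
open import Data.Sum using (_⊎_)
open import Relation.Binary.PropositionalEquality using (_≡_; _≢_)
open import Relation.Nullary using (¬_; yes; no)

-- A finite multigraph with vertex set Fin n and edge set Fin m;
-- each edge has an (unordered) pair of ends.  Loops are allowed in
-- the data type but can never lie in a perfect matching (see below),
-- so matching-covered graphs are automatically loopless.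
record Graph (n m : ℕ) : Set where
  field
    ends : Fin m → Fin n × Fin n

open Graph public

Incident : ∀ {n m} → Graph n m → Fin m → Fin n → Set
Incident H e x = proj₁ (ends H e) ≡ x ⊎ proj₂ (ends H e) ≡ x

IsPerfectMatching : ∀ {n m} → Graph n m → Subset m → Set
IsPerfectMatching {n} {m} H M =
  (∀ (e : Fin m) → e ∈ M → proj₁ (ends H e) ≢ proj₂ (ends H e)) ×
  (∀ (x : Fin n) → ∃[ e ] (e ∈ M × Incident H e x ×
      (∀ (f : Fin m) → f ∈ M → Incident H f x → f ≡ e)))

data Reach {n m : ℕ} (H : Graph n m) (x : Fin n) : Fin n → Set where
  here : Reach H x x
  step : ∀ {y z} (e : Fin m) → Reach H x y →
         (ends H e ≡ (y , z) ⊎ ends H e ≡ (z , y)) → Reach H x z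

Connected : ∀ {n m} → Graph n m → Set
Connected {n} H = ∀ (x y : Fin n) → Reach H x y

MatchingCovered : ∀ {n m} → Graph n m → Set
MatchingCovered {n} {m} H =
  Connected H × (∀ (e : Fin m) → ∃[ M ] (IsPerfectMatching H M × e ∈ M))

_⊕_ : ∀ {m} → Subset m → Subset m → Subset m
X ⊕ Y = zipWith _xor_ X Y

∇ : ∀ {n m} → Graph n m → Subset n → Subset m
∇ H U = tabulate (λ e → lookup U (proj₁ (ends H e)) xor lookup U (proj₂ (ends H e)))

Equiv : ∀ {n m} → Graph n m → Subset m → Subset m → Set
Equiv {n} H X Y = ∃[ U ] (X ≡ Y ⊕ ∇ {n} H U)

Feasible : ∀ {n m} → Graph n m → Subset m → Set
Feasible H X = ∃[ M₁ ] ∃[ M₂ ] (IsPerfectMatching H M₁ × IsPerfectMatching H M₂ ×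
  (∣ M₁ ∩ X ∣ % 2 ≢ ∣ M₂ ∩ X ∣ % 2))

NonFeasible : ∀ {n m} → Graph n m → Subset m → Set
NonFeasible H X = ¬ Feasible H X

InNStar : ∀ {n m} → Graph n m → Subset m → Set
InNStar H X = NonFeasible H X × ¬ Equiv H X ⊥ × ¬ Equiv H X ⊤

-- G' ∪ P where P is a u–v path with k internal vertices (so k+1 edges),
-- the internal vertices being the new vertices n ↑ʳ 0, …, n ↑ʳ (k-1).
-- Vertices: Fin (n + k), old vertex x is x ↑ˡ k.
-- Edges: Fin (m + suc k), old edge e is e ↑ˡ suc k, path edge i is m ↑ʳ i.
pathVertex : ∀ {n} (k : ℕ) (u v : Fin n) → ℕ → Fin (n + k)
pathVertex k u v zero = u ↑ˡ k
pathVertex {n} k u v (suc i) with i <? k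
... | yes p = n ↑ʳ fromℕ< p
... | no _  = v ↑ˡ k

addPath : ∀ {n m} → Graph n m → (k : ℕ) → Fin n → Fin n → Graph (n + k) (m + suc k)
addPath {n} {m} G' k u v = record { ends = λ e → endsOf (Data.Fin.splitAt m e) }
  where
  open import Data.Sum using (inj₁; inj₂)
  endsOf : Fin m ⊎ Fin (suc k) → Fin (n + k) × Fin (n + k)
  endsOf (inj₁ e) = (proj₁ (ends G' e) ↑ˡ k) , (proj₂ (ends G' e) ↑ˡ k)
  endsOf (inj₂ i) = pathVertex k u v (toℕ i) , pathVertex k u v (suc (toℕ i))

restrict : ∀ {m} k → Subset (m + k) → Subset m
restrict k X = tabulate (λ e → lookup X (e ↑ˡ k))

-- A set X ⊆ E(H) is non-feasible iff |M ∩ X| has the same parity for every perfect matching M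
-- of H. By the handshake lemma |M ∩ ∇(U)| ≡ |U| (mod 2) and 2|M| = |V(H)|, so this property
-- survives adding cuts and E(H). Restricting to G' sends X ⊕ ∇_G(U) to X' ⊕ ∇_G'(U ∩ V(G')),
-- which gives one direction of (i) and (ii). Every perfect matching of G' extends to G by the
-- edges of P in odd position, so X' is non-feasible along with X. Conversely, if X' ∼ Y' in G',
-- lifting the cut to G leaves a correction Z that vanishes on E(G'); a perfect matching of G
-- through the first edge of P and an extended one are complementary on P, so Z meets P in an
-- even number of edges and is therefore the cut of a set of interior vertices of P.
-- Part (iii) follows from (i), (ii) and the transfer of non-feasibility.
module Submission where

open import Defs
open import Algebra.Bundles using (CommutativeMonoid; Semiring; CommutativeRing)
open import Data.Bool using (Bool; true; false; not; _xor_; _∧_)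
open import Data.Bool.Properties
  using (xor-∧-commutativeRing; _≟_; ∧-zeroʳ; ∧-distribˡ-xor; xor-identityʳ; xor-annihilates-not;
         xor-assoc; xor-comm; xor-same)
open import Algebra.Properties.Group (CommutativeRing.+-group xor-∧-commutativeRing)
  using () renaming (∙-cancelʳ to xor-cancelʳ)
open import Algebra.Properties.CommutativeSemigroup
  (CommutativeRing.+-commutativeSemigroup xor-∧-commutativeRing) using (interchange)
open import Data.Empty using (⊥-elim)
open import Data.Fin using (Fin; zero; suc; _↑ˡ_; _↑ʳ_; punchIn; splitAt; inject₁; fromℕ; fromℕ<; toℕ)
  renaming (_≟_ to _≟ᶠ_)
open import Data.Fin.Induction using (<-weakInduction)
open import Data.Fin.Properties
  using (punchInᵢ≢i; splitAt⁻¹-↑ˡ; splitAt⁻¹-↑ʳ; splitAt-↑ˡ; splitAt-↑ʳ; toℕ-inject₁; toℕ-fromℕ;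
         toℕ-fromℕ<; toℕ<n; fromℕ<-toℕ; inject₁-injective; suc-injective; ↑ʳ-injective; ↑ˡ-injective)
open import Data.Fin.Subset using (Subset; ⊤; ⊥; _∩_; ∣_∣; _∈_)
open import Data.Nat using (ℕ; zero; suc)
open import Data.Nat.DivMod using (%-distribˡ-+)
open import Data.Nat.Properties using (+-*-semiring; *-cancelʳ-≡; +-suc; 1+n≢n; n≮n; ≤∧≢⇒<)
open import Data.Product using (_×_; _,_; proj₁; proj₂; ∃-syntax)
open import Data.Sum using (_⊎_; inj₁; inj₂)
import Data.Sum as Sum
open import Data.Vec using (Vec; []; _∷_; _++_; lookup; replicate; tabulate; zipWith)
open import Data.Vec.Properties
  using ([]=⇒lookup; lookup⇒[]=; zipWith-assoc; zipWith-comm; zipWith-identityʳ; lookup-zipWith;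
         lookup-++ˡ; lookup-++ʳ; lookup∘tabulate; tabulate∘lookup; tabulate-cong; lookup-replicate)
open import Function using (_∘_)
open import Function.Bundles using (_⇔_; mk⇔; Equivalence)
import Relation.Binary.PropositionalEquality as ≡
open ≡ using (_≡_; _≢_)
open import Relation.Nullary using (¬_; does; yes; no)
open import Relation.Nullary.Decidable using (dec-true; dec-false)

module _ {c ℓ} (M : CommutativeMonoid c ℓ) where
  open CommutativeMonoid M renaming (ε to 0#)
  open import Algebra.Properties.CommutativeMonoid.Sum M
  open import Data.Nat using (_+_)
  open import Relation.Binary.Reasoning.Setoid setoid

  sum-supported : ∀ {n} (f : Fin n → Carrier) (i : Fin n) →
    (∀ j → j ≢ i → f j ≈ 0#) → sum f ≈ f i
  sum-supported {suc n} f i f≈0 = begin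
    sum f                        ≈⟨ sum-remove f ⟩
    f i ∙ sum (f ∘ punchIn i)    ≈⟨ ∙-congˡ (sum-cong-≋ (λ j → f≈0 _ (punchInᵢ≢i i j))) ⟩
    f i ∙ sum {n} (λ _ → 0#)     ≈⟨ ∙-congˡ (sum-replicate-zero n) ⟩
    f i ∙ 0#                     ≈⟨ identityʳ (f i) ⟩
    f i                          ∎

  sum-↑ : ∀ m {k} (f : Fin (m + k) → Carrier) → sum f ≈ sum (f ∘ (_↑ˡ k)) ∙ sum (f ∘ (m ↑ʳ_))
  sum-↑ zero    f = sym (identityˡ (sum f))
  sum-↑ (suc m) f = trans (∙-congˡ (sum-↑ m (f ∘ suc))) (sym (assoc _ _ _))

module Handshake {c ℓ} (R : Semiring c ℓ) where
  open Semiring R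
  open import Algebra.Properties.Semiring.Sum R public
  open import Relation.Binary.Reasoning.Setoid setoid

  [_] : Bool → Carrier
  [ true ]  = 1#
  [ false ] = 0#

  δ : ∀ {n} → Fin n → Fin n → Carrier
  δ x y = [ does (x ≟ᶠ y) ]

  δ-refl : ∀ {n} (x : Fin n) → δ x x ≈ 1#
  δ-refl x = reflexive (≡.cong [_] (dec-true (x ≟ᶠ x) ≡.refl))

  δ-≢ : ∀ {n} {x y : Fin n} → x ≢ y → δ x y ≈ 0#
  δ-≢ {x = x} {y} x≢y = reflexive (≡.cong [_] (dec-false (x ≟ᶠ y) x≢y))

  sum-δ : ∀ {n} (x : Fin n) (w : Fin n → Carrier) → sum (λ y → δ x y * w y) ≈ w x
  sum-δ x w = begin
    sum (λ y → δ x y * w y) ≈⟨ sum-supported +-commutativeMonoid _ x δ≈0 ⟩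
    δ x x * w x             ≈⟨ *-congʳ (δ-refl x) ⟩
    1# * w x                ≈⟨ *-identityˡ (w x) ⟩
    w x                     ∎
    where
    δ≈0 : ∀ y → y ≢ x → δ x y * w y ≈ 0#
    δ≈0 y y≢x = trans (*-congʳ (δ-≢ (y≢x ∘ ≡.sym))) (zeroˡ (w y))

  module _ {n m} (H : Graph n m) where
    private
      a b : Fin m → Fin n
      a e = proj₁ (ends H e)
      b e = proj₂ (ends H e)

    incidence : Fin m → Fin n → Carrier
    incidence e x = δ (a e) x + δ (b e) x

    sum-incidence : ∀ e (w : Fin n → Carrier) → sum (λ x → incidence e x * w x) ≈ w (a e) + w (b e)
    sum-incidence e w = begin
      sum (λ x → incidence e x * w x)
        ≈⟨ sum-cong-≋ {n} (λ x → distribʳ (w x) _ _) ⟩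
      sum (λ x → δ (a e) x * w x + δ (b e) x * w x)
        ≈⟨ ∑-distrib-+ (λ x → δ (a e) x * w x) (λ x → δ (b e) x * w x) ⟩
      sum (λ x → δ (a e) x * w x) + sum (λ x → δ (b e) x * w x)
        ≈⟨ +-cong (sum-δ (a e) w) (sum-δ (b e) w) ⟩
      w (a e) + w (b e) ∎

    incidence-¬Incident : ∀ {e x} → ¬ Incident H e x → incidence e x ≈ 0#
    incidence-¬Incident e≁x = trans (+-cong (δ-≢ (e≁x ∘ inj₁)) (δ-≢ (e≁x ∘ inj₂))) (+-identityˡ 0#)

    incidence-link : ∀ {e x} → a e ≢ b e → Incident H e x → incidence e x ≈ 1#
    incidence-link {e} a≢b (inj₁ ≡.refl) =
      trans (+-cong (δ-refl (a e)) (δ-≢ (a≢b ∘ ≡.sym))) (+-identityʳ 1#)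
    incidence-link {e} a≢b (inj₂ ≡.refl) =
      trans (+-cong (δ-≢ a≢b) (δ-refl (b e))) (+-identityˡ 1#)

    handshake : ∀ {M} → IsPerfectMatching H M → (w : Fin n → Carrier) →
      sum (λ e → [ lookup M e ] * (w (a e) + w (b e))) ≈ sum w
    handshake {M} (loopless , matched) w = begin
      sum (λ e → [ lookup M e ] * (w (a e) + w (b e)))
        ≈⟨ sum-cong-≋ {m} (λ e → *-congˡ (sym (sum-incidence e w))) ⟩
      sum (λ e → [ lookup M e ] * sum (λ x → incidence e x * w x))
        ≈⟨ sum-cong-≋ {m} (λ e → *-distribˡ-sum _ (λ x → incidence e x * w x)) ⟩
      sum (λ e → sum (λ x → [ lookup M e ] * (incidence e x * w x)))
        ≈⟨ ∑-comm (λ e x → [ lookup M e ] * (incidence e x * w x)) ⟩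
      sum (λ x → sum (λ e → [ lookup M e ] * (incidence e x * w x)))
        ≈⟨ sum-cong-≋ {n} covered ⟩
      sum w ∎
      where
      covered : ∀ x → sum (λ e → [ lookup M e ] * (incidence e x * w x)) ≈ w x
      covered x with matched x
      ... | e₀ , e₀∈M , e₀~x , unique = begin
        sum (λ e → [ lookup M e ] * (incidence e x * w x))
          ≈⟨ sum-supported +-commutativeMonoid _ e₀ others≈0 ⟩
        [ lookup M e₀ ] * (incidence e₀ x * w x)
          ≈⟨ *-cong (reflexive (≡.cong [_] ([]=⇒lookup e₀∈M)))
                    (*-congʳ (incidence-link (loopless e₀ e₀∈M) e₀~x)) ⟩
        1# * (1# * w x)
          ≈⟨ trans (*-identityˡ _) (*-identityˡ (w x)) ⟩
        w x ∎
        where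
        others≈0 : ∀ e → e ≢ e₀ → [ lookup M e ] * (incidence e x * w x) ≈ 0#
        others≈0 e e≢e₀ with lookup M e in M[e]
        ... | false = zeroˡ _
        ... | true  = trans (*-congˡ (trans (*-congʳ (incidence-¬Incident e≁x)) (zeroˡ (w x)))) (zeroʳ 1#)
          where
          e≁x : ¬ Incident H e x
          e≁x e~x = e≢e₀ (unique e (lookup⇒[]= e M M[e]) e~x)

-- Opened only here, so that inside Handshake the semiring's _+_, _*_, refl, sym and trans do not
-- clash with those of ℕ and _≡_.
open import Data.Nat using (_+_; _*_; _%_; _<_; _<?_)
open ≡ using (refl; sym; trans; cong; cong₂; module ≡-Reasoning)

module 𝔽₂ = Handshake (CommutativeRing.semiring xor-∧-commutativeRing)
module Count = Handshake +-*-semiring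

lookup-extensionality : ∀ {a} {A : Set a} {n} {xs ys : Vec A n} →
  (∀ i → lookup xs i ≡ lookup ys i) → xs ≡ ys
lookup-extensionality {xs = xs} {ys} eq =
  trans (sym (tabulate∘lookup xs)) (trans (tabulate-cong eq) (tabulate∘lookup ys))

true≢false : true ≢ false
true≢false ()

lookup≡false⇒∉ : ∀ {m} {M : Subset m} {e} → lookup M e ≡ false → ¬ e ∈ M
lookup≡false⇒∉ M[e]≡false e∈M = true≢false (trans (sym ([]=⇒lookup e∈M)) M[e]≡false)

lookup-∩ : ∀ {m} (X Y : Subset m) i → lookup (X ∩ Y) i ≡ lookup X i ∧ lookup Y i
lookup-∩ X Y i = lookup-zipWith _∧_ i X Y

lookup-⊕ : ∀ {m} (X Y : Subset m) i → lookup (X ⊕ Y) i ≡ lookup X i xor lookup Y i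
lookup-⊕ X Y i = lookup-zipWith _xor_ i X Y

⊕-assoc : ∀ {m} (X Y Z : Subset m) → (X ⊕ Y) ⊕ Z ≡ X ⊕ (Y ⊕ Z)
⊕-assoc = zipWith-assoc xor-assoc

⊕-comm : ∀ {m} (X Y : Subset m) → X ⊕ Y ≡ Y ⊕ X
⊕-comm = zipWith-comm xor-comm

⊕-self : ∀ {m} (X : Subset m) → X ⊕ X ≡ ⊥
⊕-self X = lookup-extensionality λ e →
  trans (lookup-⊕ X X e) (trans (xor-same (lookup X e)) (sym (lookup-replicate e false)))

⊕-cancelʳ : ∀ {m} (X Y : Subset m) → (X ⊕ Y) ⊕ Y ≡ X
⊕-cancelʳ X Y = trans (⊕-assoc X Y Y) (trans (cong (X ⊕_) (⊕-self Y)) (zipWith-identityʳ xor-identityʳ X))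

∩-distribˡ-⊕ : ∀ {m} (M X Y : Subset m) → M ∩ (X ⊕ Y) ≡ (M ∩ X) ⊕ (M ∩ Y)
∩-distribˡ-⊕ M X Y = lookup-extensionality λ e → begin
  lookup (M ∩ (X ⊕ Y)) e                                  ≡⟨ lookup-∩ M (X ⊕ Y) e ⟩
  lookup M e ∧ lookup (X ⊕ Y) e                           ≡⟨ cong (lookup M e ∧_) (lookup-⊕ X Y e) ⟩
  lookup M e ∧ (lookup X e xor lookup Y e)                ≡⟨ ∧-distribˡ-xor (lookup M e) (lookup X e) (lookup Y e) ⟩
  (lookup M e ∧ lookup X e) xor (lookup M e ∧ lookup Y e) ≡⟨ cong₂ _xor_ (lookup-∩ M X e) (lookup-∩ M Y e) ⟨
  lookup (M ∩ X) e xor lookup (M ∩ Y) e                   ≡⟨ lookup-⊕ (M ∩ X) (M ∩ Y) e ⟨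
  lookup ((M ∩ X) ⊕ (M ∩ Y)) e                            ∎
  where open ≡-Reasoning

parity : ∀ {m} → Subset m → Bool
parity s = 𝔽₂.sum (lookup s)

𝔽₂-[]≗id : ∀ b → 𝔽₂.[ b ] ≡ b
𝔽₂-[]≗id true  = refl
𝔽₂-[]≗id false = refl

Count-[]-injective : ∀ {b c} → Count.[ b ] ≡ Count.[ c ] → b ≡ c
Count-[]-injective {true}  {true}  _ = refl
Count-[]-injective {false} {false} _ = refl

∣∣≡sum : ∀ {m} (s : Subset m) → ∣ s ∣ ≡ Count.sum (Count.[_] ∘ lookup s)
∣∣≡sum []          = refl
∣∣≡sum (true ∷ s)  = cong suc (∣∣≡sum s)
∣∣≡sum (false ∷ s) = ∣∣≡sum s

sum-ones : ∀ n → Count.sum {n} (λ _ → 1) ≡ n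
sum-ones zero    = refl
sum-ones (suc n) = cong suc (sum-ones n)

∣∣%2≡parity : ∀ {m} (s : Subset m) → ∣ s ∣ % 2 ≡ Count.[ parity s ]
∣∣%2≡parity []          = refl
∣∣%2≡parity (false ∷ s) = ∣∣%2≡parity s
∣∣%2≡parity (true ∷ s)  = begin
  (1 + ∣ s ∣) % 2               ≡⟨ %-distribˡ-+ 1 ∣ s ∣ 2 ⟩
  (1 + ∣ s ∣ % 2) % 2           ≡⟨ cong (λ r → (1 + r) % 2) (∣∣%2≡parity s) ⟩
  (1 + Count.[ parity s ]) % 2  ≡⟨ toggle (parity s) ⟩
  Count.[ not (parity s) ]      ∎
  where
  open ≡-Reasoning
  toggle : ∀ b → (1 + Count.[ b ]) % 2 ≡ Count.[ not b ]
  toggle true  = refl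
  toggle false = refl

%2≡⇔parity≡ : ∀ {m} (s t : Subset m) → ∣ s ∣ % 2 ≡ ∣ t ∣ % 2 ⇔ parity s ≡ parity t
%2≡⇔parity≡ s t = mk⇔
  (λ eq → Count-[]-injective (trans (sym (∣∣%2≡parity s)) (trans eq (∣∣%2≡parity t))))
  (λ eq → trans (∣∣%2≡parity s) (trans (cong Count.[_] eq) (sym (∣∣%2≡parity t))))

parity-⊕ : ∀ {m} (X Y : Subset m) → parity (X ⊕ Y) ≡ parity X xor parity Y
parity-⊕ X Y = trans (𝔽₂.sum-cong-≗ (lookup-⊕ X Y)) (𝔽₂.∑-distrib-+ (lookup X) (lookup Y))

parity-∩-replicate : ∀ {m} (M : Subset m) b → parity (M ∩ replicate m b) ≡ parity M ∧ b
parity-∩-replicate {m} M b = begin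
  parity (M ∩ replicate m b)
    ≡⟨ 𝔽₂.sum-cong-≗ (λ e → trans (lookup-∩ M _ e) (cong (lookup M e ∧_) (lookup-replicate e b))) ⟩
  𝔽₂.sum (λ e → lookup M e ∧ b) ≡⟨ 𝔽₂.*-distribʳ-sum b (lookup M) ⟨
  parity M ∧ b                   ∎
  where open ≡-Reasoning

sum-complementary : ∀ {k} (f g z : Fin k → Bool) → (∀ i → g i ≡ not (f i)) →
  𝔽₂.sum (λ i → f i ∧ z i) xor 𝔽₂.sum (λ i → g i ∧ z i) ≡ 𝔽₂.sum z
sum-complementary f g z g≡¬f = trans (sym (𝔽₂.∑-distrib-+ (λ i → f i ∧ z i) (λ i → g i ∧ z i)))
  (𝔽₂.sum-cong-≗ λ i → trans (cong (λ c → (f i ∧ z i) xor (c ∧ z i)) (g≡¬f i)) (split (f i) (z i)))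
  where
  split : ∀ b c → (b ∧ c) xor (not b ∧ c) ≡ c
  split true  c = xor-identityʳ c
  split false c = refl

module _ {n m} (H : Graph n m) where
  private
    a b : Fin m → Fin n
    a e = proj₁ (ends H e)
    b e = proj₂ (ends H e)

  incident⇒ : ∀ {e x y z} → ends H e ≡ (y , z) → Incident H e x → y ≡ x ⊎ z ≡ x
  incident⇒ {x = x} = ≡.subst (λ p → proj₁ p ≡ x ⊎ proj₂ p ≡ x)

  incident⇐ : ∀ {e x y z} → ends H e ≡ (y , z) → y ≡ x ⊎ z ≡ x → Incident H e x
  incident⇐ {x = x} ends≡ = ≡.subst (λ p → proj₁ p ≡ x ⊎ proj₂ p ≡ x) (sym ends≡)

  lookup-∇ : ∀ U e → lookup (∇ H U) e ≡ lookup U (a e) xor lookup U (b e)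
  lookup-∇ U e = lookup∘tabulate _ e

  lookup-∇-ends : ∀ U {e y z} → ends H e ≡ (y , z) → lookup (∇ H U) e ≡ lookup U y xor lookup U z
  lookup-∇-ends U {e} ends≡ =
    trans (lookup-∇ U e) (cong (λ p → lookup U (proj₁ p) xor lookup U (proj₂ p)) ends≡)

  ∇-⊕ : ∀ U W → ∇ H (U ⊕ W) ≡ ∇ H U ⊕ ∇ H W
  ∇-⊕ U W = lookup-extensionality λ e → begin
    lookup (∇ H (U ⊕ W)) e
      ≡⟨ lookup-∇ (U ⊕ W) e ⟩
    lookup (U ⊕ W) (a e) xor lookup (U ⊕ W) (b e)
      ≡⟨ cong₂ _xor_ (lookup-⊕ U W (a e)) (lookup-⊕ U W (b e)) ⟩
    (lookup U (a e) xor lookup W (a e)) xor (lookup U (b e) xor lookup W (b e))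
      ≡⟨ interchange (lookup U (a e)) (lookup W (a e)) (lookup U (b e)) (lookup W (b e)) ⟩
    (lookup U (a e) xor lookup U (b e)) xor (lookup W (a e) xor lookup W (b e))
      ≡⟨ cong₂ _xor_ (lookup-∇ U e) (lookup-∇ W e) ⟨
    lookup (∇ H U) e xor lookup (∇ H W) e
      ≡⟨ lookup-⊕ (∇ H U) (∇ H W) e ⟨
    lookup (∇ H U ⊕ ∇ H W) e ∎
    where open ≡-Reasoning

  parity-∩-∇ : ∀ {M} → IsPerfectMatching H M → ∀ U → parity (M ∩ ∇ H U) ≡ parity U
  parity-∩-∇ {M} pm U = trans (𝔽₂.sum-cong-≗ pointwise) (𝔽₂.handshake H pm (lookup U))
    where
    pointwise : ∀ e → lookup (M ∩ ∇ H U) e ≡ 𝔽₂.[ lookup M e ] ∧ (lookup U (a e) xor lookup U (b e))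
    pointwise e = trans (lookup-∩ M (∇ H U) e) (cong₂ _∧_ (sym (𝔽₂-[]≗id (lookup M e))) (lookup-∇ U e))

  ∣∣*2≡n : ∀ {M} → IsPerfectMatching H M → ∣ M ∣ * 2 ≡ n
  ∣∣*2≡n {M} pm = begin
    ∣ M ∣ * 2                                  ≡⟨ cong (_* 2) (∣∣≡sum M) ⟩
    Count.sum (Count.[_] ∘ lookup M) * 2       ≡⟨ Count.*-distribʳ-sum 2 (Count.[_] ∘ lookup M) ⟩
    Count.sum (λ e → Count.[ lookup M e ] * 2) ≡⟨ Count.handshake H pm (λ _ → 1) ⟩
    Count.sum {n} (λ _ → 1)                    ≡⟨ sum-ones n ⟩
    n                                          ∎
    where open ≡-Reasoning

  perfectMatching-parity : ∀ {M₁ M₂} → IsPerfectMatching H M₁ → IsPerfectMatching H M₂ →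
    parity M₁ ≡ parity M₂
  perfectMatching-parity {M₁} {M₂} pm₁ pm₂ = Equivalence.to (%2≡⇔parity≡ M₁ M₂)
    (cong (_% 2) (*-cancelʳ-≡ ∣ M₁ ∣ ∣ M₂ ∣ 2 (trans (∣∣*2≡n pm₁) (sym (∣∣*2≡n pm₂)))))

  matchingCovered⇒perfectMatching : ∀ {x y} → MatchingCovered H → x ≢ y → ∃[ M ] IsPerfectMatching H M
  matchingCovered⇒perfectMatching {x} {y} (connected , covered) x≢y with connected x y
  ... | here       = ⊥-elim (x≢y refl)
  ... | step e _ _ = proj₁ (covered e) , proj₁ (proj₂ (covered e))

ParityConstant : ∀ {n m} → Graph n m → Subset m → Set
ParityConstant H X = ∀ {M₁ M₂} → IsPerfectMatching H M₁ → IsPerfectMatching H M₂ →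
  parity (M₁ ∩ X) ≡ parity (M₂ ∩ X)

module _ {n m} (H : Graph n m) where

  nonFeasible⇔parityConstant : ∀ X → NonFeasible H X ⇔ ParityConstant H X
  nonFeasible⇔parityConstant X = mk⇔ constant nonFeasible
    where
    constant : NonFeasible H X → ParityConstant H X
    constant nf {M₁} {M₂} pm₁ pm₂ with parity (M₁ ∩ X) ≟ parity (M₂ ∩ X)
    ... | yes eq = eq
    ... | no ≢   =
      ⊥-elim (nf (M₁ , M₂ , pm₁ , pm₂ , ≢ ∘ Equivalence.to (%2≡⇔parity≡ (M₁ ∩ X) (M₂ ∩ X))))

    nonFeasible : ParityConstant H X → NonFeasible H X
    nonFeasible pc (M₁ , M₂ , pm₁ , pm₂ , ≢) =
      ≢ (Equivalence.from (%2≡⇔parity≡ (M₁ ∩ X) (M₂ ∩ X)) (pc pm₁ pm₂))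

  parityConstant-⊕ : ∀ {X Y} → ParityConstant H X → ParityConstant H Y → ParityConstant H (X ⊕ Y)
  parityConstant-⊕ {X} {Y} pcX pcY {M₁} {M₂} pm₁ pm₂ = begin
    parity (M₁ ∩ (X ⊕ Y))                 ≡⟨ cong parity (∩-distribˡ-⊕ M₁ X Y) ⟩
    parity ((M₁ ∩ X) ⊕ (M₁ ∩ Y))          ≡⟨ parity-⊕ (M₁ ∩ X) (M₁ ∩ Y) ⟩
    parity (M₁ ∩ X) xor parity (M₁ ∩ Y)   ≡⟨ cong₂ _xor_ (pcX pm₁ pm₂) (pcY pm₁ pm₂) ⟩
    parity (M₂ ∩ X) xor parity (M₂ ∩ Y)   ≡⟨ parity-⊕ (M₂ ∩ X) (M₂ ∩ Y) ⟨
    parity ((M₂ ∩ X) ⊕ (M₂ ∩ Y))          ≡⟨ cong parity (∩-distribˡ-⊕ M₂ X Y) ⟨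
    parity (M₂ ∩ (X ⊕ Y))                 ∎
    where open ≡-Reasoning

  parityConstant-∇ : ∀ U → ParityConstant H (∇ H U)
  parityConstant-∇ U pm₁ pm₂ = trans (parity-∩-∇ H pm₁ U) (sym (parity-∩-∇ H pm₂ U))

  parityConstant-replicate : ∀ b → ParityConstant H (replicate m b)
  parityConstant-replicate b {M₁} {M₂} pm₁ pm₂ = begin
    parity (M₁ ∩ replicate m b)   ≡⟨ parity-∩-replicate M₁ b ⟩
    parity M₁ ∧ b                 ≡⟨ cong (_∧ b) (perfectMatching-parity H pm₁ pm₂) ⟩
    parity M₂ ∧ b                 ≡⟨ parity-∩-replicate M₂ b ⟨
    parity (M₂ ∩ replicate m b)   ∎
    where open ≡-Reasoning

lookup-restrict : ∀ {m} k (X : Subset (m + k)) e → lookup (restrict k X) e ≡ lookup X (e ↑ˡ k)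
lookup-restrict k X e = lookup∘tabulate _ e

restrict-zipWith : ∀ {m} k (f : Bool → Bool → Bool) (X Y : Subset (m + k)) →
  restrict k (zipWith f X Y) ≡ zipWith f (restrict k X) (restrict k Y)
restrict-zipWith k f X Y = lookup-extensionality λ e → begin
  lookup (restrict k (zipWith f X Y)) e                 ≡⟨ lookup-restrict k (zipWith f X Y) e ⟩
  lookup (zipWith f X Y) (e ↑ˡ k)                       ≡⟨ lookup-zipWith f (e ↑ˡ k) X Y ⟩
  f (lookup X (e ↑ˡ k)) (lookup Y (e ↑ˡ k))             ≡⟨ cong₂ f (lookup-restrict k X e) (lookup-restrict k Y e) ⟨
  f (lookup (restrict k X) e) (lookup (restrict k Y) e) ≡⟨ lookup-zipWith f e (restrict k X) (restrict k Y) ⟨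
  lookup (zipWith f (restrict k X) (restrict k Y)) e    ∎
  where open ≡-Reasoning

restrict-replicate : ∀ {m} k b → restrict k (replicate (m + k) b) ≡ replicate m b
restrict-replicate {m} k b = lookup-extensionality λ e → trans (lookup-restrict k (replicate (m + k) b) e)
  (trans (lookup-replicate (e ↑ˡ k) b) (sym (lookup-replicate e b)))

restrict-++ : ∀ {m} k (xs : Subset m) (ys : Subset k) → restrict k (xs ++ ys) ≡ xs
restrict-++ k xs ys = lookup-extensionality λ e → trans (lookup-restrict k (xs ++ ys) e) (lookup-++ˡ xs ys e)

parity-↑ : ∀ {m} k (X : Subset (m + k)) →
  parity X ≡ parity (restrict k X) xor 𝔽₂.sum (λ i → lookup X (m ↑ʳ i))
parity-↑ {m} k X = trans (sum-↑ (CommutativeRing.+-commutativeMonoid xor-∧-commutativeRing) m (lookup X))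
  (cong (_xor 𝔽₂.sum (λ i → lookup X (m ↑ʳ i))) (sym (𝔽₂.sum-cong-≗ (lookup-restrict k X))))

data Split (m k : ℕ) : Fin (m + k) → Set where
  left  : (i : Fin m) → Split m k (i ↑ˡ k)
  right : (j : Fin k) → Split m k (m ↑ʳ j)

split : ∀ m {k} (i : Fin (m + k)) → Split m k i
split m i with splitAt m i in eq
... | inj₁ j = ≡.subst (Split m _) (splitAt⁻¹-↑ˡ eq) (left j)
... | inj₂ j = ≡.subst (Split m _) (splitAt⁻¹-↑ʳ eq) (right j)

data LastView : ∀ {k} → Fin (suc k) → Set where
  inject : ∀ {k} (t : Fin k) → LastView (inject₁ t)
  last   : ∀ {k} → LastView (fromℕ k)

lastView : ∀ {k} (i : Fin (suc k)) → LastView i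
lastView {zero}  zero    = last
lastView {suc k} zero    = inject zero
lastView {suc k} (suc i) with lastView i
... | inject t = inject (suc t)
... | last     = last

inject₁≢suc : ∀ {k} (t : Fin k) → inject₁ t ≢ suc t
inject₁≢suc t eq = 1+n≢n (sym (trans (sym (toℕ-inject₁ t)) (cong toℕ eq)))

inject₁≡suc⇒ : ∀ {k} {i : Fin (suc k)} {t : Fin k} → inject₁ i ≡ suc (inject₁ t) → i ≡ suc t
inject₁≡suc⇒ {i = suc i} eq = cong suc (inject₁-injective (suc-injective eq))

isOdd : ℕ → Bool
isOdd zero    = false
isOdd (suc n) = not (isOdd n)

isOdd-2* : ∀ j → isOdd (2 * j) ≡ false
isOdd-2* zero    = refl
isOdd-2* (suc j) rewrite +-suc j (j + 0) | isOdd-2* j = refl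

prefix : ∀ {k} → (Fin k → Bool) → Fin (suc k) → Bool
prefix         z zero    = false
prefix {suc k} z (suc i) = z zero xor prefix (z ∘ suc) i

prefix-step : ∀ {k} (z : Fin k → Bool) i → prefix z (inject₁ i) xor prefix z (suc i) ≡ z i
prefix-step {suc k} z zero    = xor-identityʳ (z zero)
prefix-step {suc k} z (suc i) with z zero
... | false = prefix-step (z ∘ suc) i
... | true  = trans (xor-annihilates-not (prefix (z ∘ suc) (inject₁ i)) (prefix (z ∘ suc) (suc i)))
                    (prefix-step (z ∘ suc) i)

prefix-fromℕ : ∀ {k} (z : Fin k → Bool) → prefix z (fromℕ k) ≡ 𝔽₂.sum z
prefix-fromℕ {zero}  z = refl
prefix-fromℕ {suc k} z = cong (z zero xor_) (prefix-fromℕ (z ∘ suc))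

module PathExtension {n m} (G' : Graph n m) (k : ℕ) (u v : Fin n) where

  G : Graph (n + k) (m + suc k)
  G = addPath G' k u v

  inner : Fin k → Fin (n + k)
  inner t = n ↑ʳ t

  pathEdge : Fin (suc k) → Fin (m + suc k)
  pathEdge i = m ↑ʳ i

  -- P runs through position 0 = u, …, position (k + 1) = v.
  position : Fin (suc (suc k)) → Fin (n + k)
  position p = pathVertex k u v (toℕ p)

  ends-↑ˡ : ∀ e → ends G (e ↑ˡ suc k) ≡ (proj₁ (ends G' e) ↑ˡ k , proj₂ (ends G' e) ↑ˡ k)
  ends-↑ˡ e rewrite splitAt-↑ˡ m e (suc k) = refl

  ends-pathEdge : ∀ i → ends G (pathEdge i) ≡ (position (inject₁ i) , position (suc i))
  ends-pathEdge i rewrite splitAt-↑ʳ m (suc k) i | toℕ-inject₁ i = refl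

  ↑ˡ≢inner : ∀ x t → x ↑ˡ k ≢ inner t
  ↑ˡ≢inner x t eq with trans (sym (splitAt-↑ˡ n x k)) (trans (cong (splitAt n) eq) (splitAt-↑ʳ n k t))
  ... | ()

  pathVertex-inner : ∀ {s} (s<k : s < k) → pathVertex k u v (suc s) ≡ inner (fromℕ< s<k)
  pathVertex-inner {s} s<k with s <? k
  ... | yes _   = refl
  ... | no  s≮k = ⊥-elim (s≮k s<k)

  position-inner : ∀ t → position (suc (inject₁ t)) ≡ inner t
  position-inner t rewrite toℕ-inject₁ t =
    trans (pathVertex-inner (toℕ<n t)) (cong inner (fromℕ<-toℕ t (toℕ<n t)))

  position-end : position (fromℕ (suc k)) ≡ v ↑ˡ k
  position-end rewrite toℕ-fromℕ k with k <? k
  ... | yes k<k = ⊥-elim (n≮n k k<k)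
  ... | no  _   = refl

  data PositionView : Fin (suc (suc k)) → Set where
    start    : PositionView zero
    interior : (t : Fin k) → PositionView (suc (inject₁ t))
    end      : PositionView (fromℕ (suc k))

  positionView : ∀ p → PositionView p
  positionView zero = start
  positionView (suc i) with lastView i
  ... | inject t = interior t
  ... | last     = end

  position≡inner⇒ : ∀ {p t} → position p ≡ inner t → p ≡ suc (inject₁ t)
  position≡inner⇒ {p} {t} eq with positionView p
  ... | start       = ⊥-elim (↑ˡ≢inner u t eq)
  ... | interior t′ = cong (suc ∘ inject₁) (↑ʳ-injective n t′ t (trans (sym (position-inner t′)) eq))
  ... | end         = ⊥-elim (↑ˡ≢inner v t (trans (sym position-end) eq))

  incident-inner : ∀ {e t} → Incident G e (inner t) → e ≡ pathEdge (inject₁ t) ⊎ e ≡ pathEdge (suc t)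
  incident-inner {e} {t} e~t with split m e
  ... | left e′ = ⊥-elim (Sum.[ ↑ˡ≢inner _ t , ↑ˡ≢inner _ t ] (incident⇒ G (ends-↑ˡ e′) e~t))
  ... | right i = Sum.map (λ eq → cong pathEdge (suc-injective (position≡inner⇒ eq)))
                          (λ eq → cong pathEdge (inject₁≡suc⇒ (position≡inner⇒ eq)))
                          (Sum.swap (incident⇒ G (ends-pathEdge i) e~t))

  pathEdge-inject₁~inner : ∀ t → Incident G (pathEdge (inject₁ t)) (inner t)
  pathEdge-inject₁~inner t = incident⇐ G (ends-pathEdge (inject₁ t)) (inj₂ (position-inner t))

  pathEdge-suc~inner : ∀ t → Incident G (pathEdge (suc t)) (inner t)
  pathEdge-suc~inner t = incident⇐ G (ends-pathEdge (suc t)) (inj₁ (position-inner t))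

  pathEdge-inject₁≢suc : ∀ t → pathEdge (inject₁ t) ≢ pathEdge (suc t)
  pathEdge-inject₁≢suc t = inject₁≢suc t ∘ ↑ʳ-injective m (inject₁ t) (suc t)

  perfectMatching-alternates : ∀ {M} → IsPerfectMatching G M → ∀ t →
    lookup M (pathEdge (suc t)) ≡ not (lookup M (pathEdge (inject₁ t)))
  perfectMatching-alternates {M} (_ , matched) t
    with matched (inner t) | lookup M (pathEdge (inject₁ t)) in M[e₁] | lookup M (pathEdge (suc t)) in M[e₂]
  ... | _ | true  | false = refl
  ... | _ | false | true  = refl
  ... | _ , _ , _ , unique | true | true = ⊥-elim (pathEdge-inject₁≢suc t (trans
          (unique _ (lookup⇒[]= _ M M[e₁]) (pathEdge-inject₁~inner t))
          (sym (unique _ (lookup⇒[]= _ M M[e₂]) (pathEdge-suc~inner t)))))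
  ... | e₀ , e₀∈M , e₀~t , _ | false | false with incident-inner e₀~t
  ...   | inj₁ refl = ⊥-elim (lookup≡false⇒∉ M[e₁] e₀∈M)
  ...   | inj₂ refl = ⊥-elim (lookup≡false⇒∉ M[e₂] e₀∈M)

  alternating⇒inner-matched : ∀ {M} t →
    lookup M (pathEdge (suc t)) ≡ not (lookup M (pathEdge (inject₁ t))) →
    ∃[ e ] (e ∈ M × Incident G e (inner t) × (∀ f → f ∈ M → Incident G f (inner t) → f ≡ e))
  alternating⇒inner-matched {M} t alt with lookup M (pathEdge (inject₁ t)) in M[e₁]
  ... | true = pathEdge (inject₁ t) , lookup⇒[]= _ M M[e₁] , pathEdge-inject₁~inner t , unique
    where
    unique : ∀ f → f ∈ M → Incident G f (inner t) → f ≡ pathEdge (inject₁ t)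
    unique f f∈M f~t with incident-inner f~t
    ... | inj₁ f≡e₁ = f≡e₁
    ... | inj₂ refl = ⊥-elim (lookup≡false⇒∉ alt f∈M)
  ... | false = pathEdge (suc t) , lookup⇒[]= _ M alt , pathEdge-suc~inner t , unique
    where
    unique : ∀ f → f ∈ M → Incident G f (inner t) → f ≡ pathEdge (suc t)
    unique f f∈M f~t with incident-inner f~t
    ... | inj₁ refl = ⊥-elim (lookup≡false⇒∉ M[e₁] f∈M)
    ... | inj₂ f≡e₂ = f≡e₂

  perfectMatchings-complementary : ∀ {M₁ M₂} → IsPerfectMatching G M₁ → IsPerfectMatching G M₂ →
    lookup M₂ (pathEdge zero) ≡ not (lookup M₁ (pathEdge zero)) →
    ∀ i → lookup M₂ (pathEdge i) ≡ not (lookup M₁ (pathEdge i))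
  perfectMatchings-complementary {M₁} {M₂} pm₁ pm₂ at-zero =
    <-weakInduction (λ i → lookup M₂ (pathEdge i) ≡ not (lookup M₁ (pathEdge i))) at-zero alternate
    where
    alternate : ∀ t → lookup M₂ (pathEdge (inject₁ t)) ≡ not (lookup M₁ (pathEdge (inject₁ t))) →
      lookup M₂ (pathEdge (suc t)) ≡ not (lookup M₁ (pathEdge (suc t)))
    alternate t hyp = trans (perfectMatching-alternates pm₂ t)
      (trans (cong not hyp) (cong not (sym (perfectMatching-alternates pm₁ t))))

  restrict-∇ : ∀ U → restrict (suc k) (∇ G U) ≡ ∇ G' (restrict k U)
  restrict-∇ U = lookup-extensionality λ e → begin
    lookup (restrict (suc k) (∇ G U)) e
      ≡⟨ lookup-restrict (suc k) (∇ G U) e ⟩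
    lookup (∇ G U) (e ↑ˡ suc k)
      ≡⟨ lookup-∇-ends G U (ends-↑ˡ e) ⟩
    lookup U (a e ↑ˡ k) xor lookup U (b e ↑ˡ k)
      ≡⟨ cong₂ _xor_ (lookup-restrict k U (a e)) (lookup-restrict k U (b e)) ⟨
    lookup (restrict k U) (a e) xor lookup (restrict k U) (b e)
      ≡⟨ lookup-∇ G' (restrict k U) e ⟨
    lookup (∇ G' (restrict k U)) e ∎
    where
    open ≡-Reasoning
    a b : Fin m → Fin n
    a e = proj₁ (ends G' e)
    b e = proj₂ (ends G' e)

  restrict-cut : ∀ b U → restrict (suc k) (replicate _ b ⊕ ∇ G U) ≡ replicate m b ⊕ ∇ G' (restrict k U)
  restrict-cut b U = trans (restrict-zipWith (suc k) _xor_ (replicate _ b) (∇ G U))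
    (cong₂ _⊕_ (restrict-replicate (suc k) b) (restrict-∇ U))

  equiv-restrict : ∀ {X} b → Equiv G X (replicate _ b) → Equiv G' (restrict (suc k) X) (replicate m b)
  equiv-restrict b (U , X≡) = restrict k U , trans (cong (restrict (suc k)) X≡) (restrict-cut b U)

  parity-∩-pathSupported : ∀ M Z → restrict (suc k) Z ≡ ⊥ →
    parity (M ∩ Z) ≡ 𝔽₂.sum (λ i → lookup M (pathEdge i) ∧ lookup Z (pathEdge i))
  parity-∩-pathSupported M Z Z-path = begin
    parity (M ∩ Z)
      ≡⟨ parity-↑ (suc k) (M ∩ Z) ⟩
    parity (restrict (suc k) (M ∩ Z)) xor onPath
      ≡⟨ cong (λ Y → parity Y xor onPath) restrict-M∩Z ⟩
    parity (restrict (suc k) M ∩ ⊥) xor onPath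
      ≡⟨ cong (_xor onPath) (parity-∩-replicate (restrict (suc k) M) false) ⟩
    (parity (restrict (suc k) M) ∧ false) xor onPath
      ≡⟨ cong (_xor onPath) (∧-zeroʳ (parity (restrict (suc k) M))) ⟩
    onPath
      ≡⟨ 𝔽₂.sum-cong-≗ (lookup-∩ M Z ∘ pathEdge) ⟩
    𝔽₂.sum (λ i → lookup M (pathEdge i) ∧ lookup Z (pathEdge i)) ∎
    where
    open ≡-Reasoning
    onPath : Bool
    onPath = 𝔽₂.sum (lookup (M ∩ Z) ∘ pathEdge)
    restrict-M∩Z : restrict (suc k) (M ∩ Z) ≡ restrict (suc k) M ∩ ⊥
    restrict-M∩Z = trans (restrict-zipWith (suc k) _∧_ M Z) (cong (restrict (suc k) M ∩_) Z-path)

  cut-on-path : ∀ Z → restrict (suc k) Z ≡ ⊥ → 𝔽₂.sum (lookup Z ∘ pathEdge) ≡ false →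
    ∃[ W ] Z ≡ ∇ G W
  cut-on-path Z Z-path even = W , sym (lookup-extensionality ∇W≗Z)
    where
    -- The interior vertex at position p is put into W iff Z meets P an odd number of times before p.
    W : Subset (n + k)
    W = replicate n false ++ tabulate (prefix (lookup Z ∘ pathEdge) ∘ suc ∘ inject₁)

    W-↑ˡ : ∀ x → lookup W (x ↑ˡ k) ≡ false
    W-↑ˡ x = trans (lookup-++ˡ (replicate n false) _ x) (lookup-replicate x false)

    W-position : ∀ p → lookup W (position p) ≡ prefix (lookup Z ∘ pathEdge) p
    W-position p with positionView p
    ... | start      = W-↑ˡ u
    ... | interior t = trans (cong (lookup W) (position-inner t))
                         (trans (lookup-++ʳ (replicate n false) _ t) (lookup∘tabulate _ t))
    ... | end        = trans (cong (lookup W) position-end)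
                         (trans (W-↑ˡ v) (sym (trans (prefix-fromℕ (lookup Z ∘ pathEdge)) even)))

    ∇W≗Z : ∀ e → lookup (∇ G W) e ≡ lookup Z e
    ∇W≗Z e with split m e
    ... | left e′ = begin
      lookup (∇ G W) (e′ ↑ˡ suc k)
        ≡⟨ lookup-∇-ends G W (ends-↑ˡ e′) ⟩
      lookup W (proj₁ (ends G' e′) ↑ˡ k) xor lookup W (proj₂ (ends G' e′) ↑ˡ k)
        ≡⟨ cong₂ _xor_ (W-↑ˡ _) (W-↑ˡ _) ⟩
      false                            ≡⟨ lookup-replicate e′ false ⟨
      lookup (replicate m false) e′    ≡⟨ cong (λ Y → lookup Y e′) Z-path ⟨
      lookup (restrict (suc k) Z) e′   ≡⟨ lookup-restrict (suc k) Z e′ ⟩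
      lookup Z (e′ ↑ˡ suc k)           ∎
      where open ≡-Reasoning
    ... | right i = begin
      lookup (∇ G W) (pathEdge i)                             ≡⟨ lookup-∇-ends G W (ends-pathEdge i) ⟩
      lookup W (position (inject₁ i)) xor lookup W (position (suc i))
        ≡⟨ cong₂ _xor_ (W-position (inject₁ i)) (W-position (suc i)) ⟩
      prefix (lookup Z ∘ pathEdge) (inject₁ i) xor prefix (lookup Z ∘ pathEdge) (suc i)
        ≡⟨ prefix-step (lookup Z ∘ pathEdge) i ⟩
      lookup Z (pathEdge i)                                   ∎
      where open ≡-Reasoning

  extend : Subset m → Subset (m + suc k)
  extend N = N ++ tabulate (isOdd ∘ toℕ)

  lookup-extend-pathEdge : ∀ N i → lookup (extend N) (pathEdge i) ≡ isOdd (toℕ i)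
  lookup-extend-pathEdge N i = trans (lookup-++ʳ N _ i) (lookup∘tabulate (isOdd ∘ toℕ) i)

  ↑ˡ∈extend⇔ : ∀ N e → e ↑ˡ suc k ∈ extend N ⇔ e ∈ N
  ↑ˡ∈extend⇔ N e = mk⇔
    (λ e∈ → lookup⇒[]= e N (trans (sym (lookup-++ˡ N _ e)) ([]=⇒lookup e∈)))
    (λ e∈ → lookup⇒[]= _ (extend N) (trans (lookup-++ˡ N _ e) ([]=⇒lookup e∈)))

  parity-extend-∩ : ∀ N X → parity (extend N ∩ X) ≡
    parity (N ∩ restrict (suc k) X) xor 𝔽₂.sum (λ i → isOdd (toℕ i) ∧ lookup X (pathEdge i))
  parity-extend-∩ N X = trans (parity-↑ (suc k) (extend N ∩ X)) (cong₂ _xor_ (cong parity restrict-extend-∩)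
    (𝔽₂.sum-cong-≗ λ i → trans (lookup-∩ (extend N) X (pathEdge i))
                                (cong (_∧ lookup X (pathEdge i)) (lookup-extend-pathEdge N i))))
    where
    restrict-extend-∩ : restrict (suc k) (extend N ∩ X) ≡ N ∩ restrict (suc k) X
    restrict-extend-∩ = trans (restrict-zipWith (suc k) _∧_ (extend N) X)
      (cong (_∩ restrict (suc k) X) (restrict-++ (suc k) N _))

  module _ (k-even : isOdd k ≡ false) where

    oddPathEdge-ends : ∀ i → isOdd (toℕ i) ≡ true →
      ∃[ t ] ∃[ t′ ] (t ≢ t′ × ends G (pathEdge i) ≡ (inner t , inner t′))
    oddPathEdge-ends (suc t) odd = t , fromℕ< s<k , t≢t′ ,
      trans (ends-pathEdge (suc t)) (cong₂ _,_ (position-inner t) (pathVertex-inner s<k))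
      where
      s<k : suc (toℕ t) < k
      s<k = ≤∧≢⇒< (toℕ<n t) (λ s≡k → true≢false (trans (sym odd) (trans (cong isOdd s≡k) k-even)))
      t≢t′ : t ≢ fromℕ< s<k
      t≢t′ eq = 1+n≢n (sym (trans (cong toℕ eq) (toℕ-fromℕ< s<k)))

    extend-perfect : ∀ {N} → IsPerfectMatching G' N → IsPerfectMatching G (extend N)
    extend-perfect {N} (loopless′ , matched′) = loopless , matched
      where
      pathEdge∈⇒odd : ∀ {i} → pathEdge i ∈ extend N → isOdd (toℕ i) ≡ true
      pathEdge∈⇒odd {i} i∈ = trans (sym (lookup-extend-pathEdge N i)) ([]=⇒lookup i∈)

      loopless : ∀ e → e ∈ extend N → proj₁ (ends G e) ≢ proj₂ (ends G e)
      loopless e e∈ with split m e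
      ... | left e′ rewrite ends-↑ˡ e′ =
            loopless′ e′ (Equivalence.to (↑ˡ∈extend⇔ N e′) e∈) ∘ ↑ˡ-injective k _ _
      ... | right i with oddPathEdge-ends i (pathEdge∈⇒odd e∈)
      ...   | t , t′ , t≢t′ , ends≡ rewrite ends≡ = t≢t′ ∘ ↑ʳ-injective n t t′

      matched : ∀ x → ∃[ e ] (e ∈ extend N × Incident G e x ×
        (∀ f → f ∈ extend N → Incident G f x → f ≡ e))
      matched x with split n x
      ... | right t = alternating⇒inner-matched t (begin
        lookup (extend N) (pathEdge (suc t))            ≡⟨ lookup-extend-pathEdge N (suc t) ⟩
        not (isOdd (toℕ t))                             ≡⟨ cong (not ∘ isOdd) (toℕ-inject₁ t) ⟨
        not (isOdd (toℕ (inject₁ t)))                   ≡⟨ cong not (lookup-extend-pathEdge N (inject₁ t)) ⟨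
        not (lookup (extend N) (pathEdge (inject₁ t)))  ∎)
        where open ≡-Reasoning
      ... | left x′ with matched′ x′
      ...   | e₀ , e₀∈N , e₀~x′ , unique′ =
        e₀ ↑ˡ suc k , Equivalence.from (↑ˡ∈extend⇔ N e₀) e₀∈N ,
        incident⇐ G (ends-↑ˡ e₀) (Sum.map (cong (_↑ˡ k)) (cong (_↑ˡ k)) e₀~x′) , unique
        where
        unique : ∀ f → f ∈ extend N → Incident G f (x′ ↑ˡ k) → f ≡ e₀ ↑ˡ suc k
        unique f f∈ f~x with split m f
        ... | left f′ = cong (_↑ˡ suc k) (unique′ f′ (Equivalence.to (↑ˡ∈extend⇔ N f′) f∈)
                (Sum.map (↑ˡ-injective k _ _) (↑ˡ-injective k _ _) (incident⇒ G (ends-↑ˡ f′) f~x)))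
        ... | right i with oddPathEdge-ends i (pathEdge∈⇒odd f∈)
        ...   | t , t′ , _ , ends≡ =
          ⊥-elim (Sum.[ ↑ˡ≢inner x′ t ∘ sym , ↑ˡ≢inner x′ t′ ∘ sym ] (incident⇒ G ends≡ f~x))

    parityConstant-restrict : ∀ {X} → ParityConstant G X → ParityConstant G' (restrict (suc k) X)
    parityConstant-restrict {X} pcX {N₁} {N₂} pm₁ pm₂ = xor-cancelʳ c _ _ (begin
      parity (N₁ ∩ restrict (suc k) X) xor c  ≡⟨ parity-extend-∩ N₁ X ⟨
      parity (extend N₁ ∩ X)                  ≡⟨ pcX (extend-perfect pm₁) (extend-perfect pm₂) ⟩
      parity (extend N₂ ∩ X)                  ≡⟨ parity-extend-∩ N₂ X ⟩
      parity (N₂ ∩ restrict (suc k) X) xor c  ∎)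
      where
      open ≡-Reasoning
      c : Bool
      c = 𝔽₂.sum (λ i → isOdd (toℕ i) ∧ lookup X (pathEdge i))

    module _ {N M} (N-perfect : IsPerfectMatching G' N) (M-perfect : IsPerfectMatching G M)
             (pathEdge₀∈M : pathEdge zero ∈ M) where

      pathSum-even : ∀ {Z} → ParityConstant G Z → restrict (suc k) Z ≡ ⊥ →
        𝔽₂.sum (lookup Z ∘ pathEdge) ≡ false
      pathSum-even {Z} pcZ Z-path = begin
        𝔽₂.sum (lookup Z ∘ pathEdge)
          ≡⟨ sum-complementary (lookup M ∘ pathEdge) (lookup (extend N) ∘ pathEdge) (lookup Z ∘ pathEdge)
               (perfectMatchings-complementary M-perfect extend-N-perfect first-edge) ⟨
        𝔽₂.sum (λ i → lookup M (pathEdge i) ∧ lookup Z (pathEdge i)) xor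
        𝔽₂.sum (λ i → lookup (extend N) (pathEdge i) ∧ lookup Z (pathEdge i))
          ≡⟨ cong₂ _xor_ (parity-∩-pathSupported M Z Z-path) (parity-∩-pathSupported (extend N) Z Z-path) ⟨
        parity (M ∩ Z) xor parity (extend N ∩ Z)
          ≡⟨ cong (parity (M ∩ Z) xor_) (pcZ extend-N-perfect M-perfect) ⟩
        parity (M ∩ Z) xor parity (M ∩ Z)
          ≡⟨ xor-same (parity (M ∩ Z)) ⟩
        false ∎
        where
        open ≡-Reasoning
        extend-N-perfect : IsPerfectMatching G (extend N)
        extend-N-perfect = extend-perfect N-perfect
        first-edge : lookup (extend N) (pathEdge zero) ≡ not (lookup M (pathEdge zero))
        first-edge = trans (lookup-extend-pathEdge N zero) (cong not (sym ([]=⇒lookup pathEdge₀∈M)))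

      equiv-lift : ∀ {X} → ParityConstant G X →
        ∀ b → Equiv G' (restrict (suc k) X) (replicate m b) → Equiv G X (replicate _ b)
      equiv-lift {X} pcX b (U′ , X′≡) = U ⊕ W , (begin
        X                      ≡⟨ ⊕-cancelʳ X Y ⟨
        Z ⊕ Y                  ≡⟨ cong (_⊕ Y) Z≡∇W ⟩
        ∇ G W ⊕ (B ⊕ ∇ G U)    ≡⟨ ⊕-comm (∇ G W) Y ⟩
        (B ⊕ ∇ G U) ⊕ ∇ G W    ≡⟨ ⊕-assoc B (∇ G U) (∇ G W) ⟩
        B ⊕ (∇ G U ⊕ ∇ G W)    ≡⟨ cong (B ⊕_) (∇-⊕ G U W) ⟨
        B ⊕ ∇ G (U ⊕ W)        ∎)
        where
        open ≡-Reasoning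
        U : Subset (n + k)
        U = U′ ++ replicate k false
        B Y Z : Subset (m + suc k)
        B = replicate _ b
        Y = B ⊕ ∇ G U
        Z = X ⊕ Y
        Z-path : restrict (suc k) Z ≡ ⊥
        Z-path = begin
          restrict (suc k) (X ⊕ Y)                                   ≡⟨ restrict-zipWith (suc k) _xor_ X Y ⟩
          restrict (suc k) X ⊕ restrict (suc k) Y                    ≡⟨ cong (restrict (suc k) X ⊕_) (restrict-cut b U) ⟩
          restrict (suc k) X ⊕ (replicate m b ⊕ ∇ G' (restrict k U))
            ≡⟨ cong (λ V → restrict (suc k) X ⊕ (replicate m b ⊕ ∇ G' V)) (restrict-++ k U′ _) ⟩
          restrict (suc k) X ⊕ (replicate m b ⊕ ∇ G' U′)             ≡⟨ cong (restrict (suc k) X ⊕_) X′≡ ⟨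
          restrict (suc k) X ⊕ restrict (suc k) X                    ≡⟨ ⊕-self (restrict (suc k) X) ⟩
          ⊥                                                          ∎
        Z-constant : ParityConstant G Z
        Z-constant = parityConstant-⊕ G pcX
          (parityConstant-⊕ G (parityConstant-replicate G b) (parityConstant-∇ G U))
        Z-cut : ∃[ W ] Z ≡ ∇ G W
        Z-cut = cut-on-path Z Z-path (pathSum-even Z-constant Z-path)
        W : Subset (n + k)
        W = proj₁ Z-cut
        Z≡∇W : Z ≡ ∇ G W
        Z≡∇W = proj₂ Z-cut

lemma3p2 : ∀ {n m} (G' : Graph n m) (j : ℕ) (u v : Fin n) → u ≢ v →
    MatchingCovered G' → MatchingCovered (addPath G' (2 * j) u v) →
    (X : Subset (m + suc (2 * j))) → NonFeasible (addPath G' (2 * j) u v) X →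
      (Equiv G' (restrict (suc (2 * j)) X) ⊥ ⇔ Equiv (addPath G' (2 * j) u v) X ⊥)
    × (Equiv G' (restrict (suc (2 * j)) X) ⊤ ⇔ Equiv (addPath G' (2 * j) u v) X ⊤)
    × (InNStar G' (restrict (suc (2 * j)) X) ⇔ InNStar (addPath G' (2 * j) u v) X)
lemma3p2 {n} {m} G' j u v u≢v G'-covered G-covered X X-nonFeasible =
  equiv⇔ false , equiv⇔ true ,
  mk⇔ (λ { (_ , ≁⊥ , ≁⊤) → X-nonFeasible , ≁⊥ ∘ equiv-restrict false , ≁⊤ ∘ equiv-restrict true })
      (λ { (_ , ≁⊥ , ≁⊤) → X′-nonFeasible , ≁⊥ ∘ lift false , ≁⊤ ∘ lift true })
  where
  open PathExtension G' (2 * j) u v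
  X-constant : ParityConstant G X
  X-constant = Equivalence.to (nonFeasible⇔parityConstant G X) X-nonFeasible
  X′-nonFeasible : NonFeasible G' (restrict (suc (2 * j)) X)
  X′-nonFeasible = Equivalence.from (nonFeasible⇔parityConstant G' _)
    (parityConstant-restrict (isOdd-2* j) X-constant)
  lift : ∀ b → Equiv G' (restrict (suc (2 * j)) X) (replicate m b) → Equiv G X (replicate _ b)
  lift with matchingCovered⇒perfectMatching G' G'-covered u≢v | proj₂ G-covered (pathEdge zero)
  ... | _ , N-perfect | _ , M-perfect , pathEdge₀∈M =
    equiv-lift (isOdd-2* j) N-perfect M-perfect pathEdge₀∈M X-constant
  equiv⇔ : ∀ b → Equiv G' (restrict (suc (2 * j)) X) (replicate m b) ⇔ Equiv G X (replicate _ b)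
  equiv⇔ b = mk⇔ (lift b) (equiv-restrict b)
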